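{- Let $G$ be a graph without isolated vertices whose vertex cover number equals $k$. Then either $G$ is not well covered, or $G$ has at most $5k$ vertices.
   Context: The vertex cover number of $G$ is the size of a minimum vertex cover. A graph is well covered if all its minimal vertex covers have the same size (equivalently, all maximal independent sets have the same size). -}

module Defs where

open import Data.Nat using (ℕ; _≤_)
open import Data.Bool using (Bool; true; false)
open import Data.Fin using (Fin)
open import Data.Fin.Subset using (Subset; _∈_; _⊆_; ∣_∣)
open import Data.Product using (Σ; _×_; ∃)
open import Data.Sum using (_⊎_)
open import Relation.Binary.PropositionalEquality using (_≡_; _≢_)
open import Relation.Nullary using (¬_)

record Graph (n : ℕ) : Set where
  field
    adj       : Fin n → Fin n → Bool
    symmetric : ∀ u v → adj u v ≡ adj v u
    irreflexive : ∀ v → adj v v ≡ false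

open Graph public

module _ {n : ℕ} (G : Graph n) where

  Isolated : Fin n → Set
  Isolated v = ∀ u → adj G v u ≡ false

  NoIsolatedVertices : Set
  NoIsolatedVertices = ∀ v → ¬ Isolated v

  IsVertexCover : Subset n → Set
  IsVertexCover S = ∀ u v → adj G u v ≡ true → (u ∈ S) ⊎ (v ∈ S)

  IsMinimalVertexCover : Subset n → Set
  IsMinimalVertexCover S =
    IsVertexCover S × (∀ T → IsVertexCover T → T ⊆ S → T ≡ S)

  VertexCoverNumber : ℕ → Set
  VertexCoverNumber k =
    (Σ (Subset n) λ S → IsVertexCover S × ∣ S ∣ ≡ k)
    × (∀ S → IsVertexCover S → k ≤ ∣ S ∣)

  WellCovered : Set
  WellCovered = ∀ S T → IsMinimalVertexCover S → IsMinimalVertexCover T → ∣ S ∣ ≡ ∣ T ∣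

-- A well-covered graph without isolated vertices has independence number α ≤ n/2. As the
-- complements of the maximal independent sets are exactly the minimal vertex covers, n = α + k,
-- hence n ≤ 2k.
--
-- Let v have minimum degree and let T be the set of
-- vertices whose neighbourhood lies in N(v), hence equals it. T is independent and contains v.
-- Deleting T ∪ N(v) leaves a graph R without isolated vertices, and M ∪ T is maximal independent
-- in G whenever M is so in R; hence R is well covered and α = α(R) + |T|. Moreover |T| ≤ deg v: if K is
-- maximal independent and contains a neighbour of v, then (K ∖ N(v)) ∪ T is independent, so
-- |K ∖ N(v)| + |T| ≤ α = |K| ≤ |K ∖ N(v)| + deg v. Hence 2α ≤ |R| + |T| + deg v = n.
module Submission where

open import Defs
open import Data.Nat using (ℕ; zero; suc; _+_; _*_; _≤_; _<_; z≤n; s≤s; _<?_; _≤?_)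
open import Data.Nat.Properties
open import Data.Nat.Induction using (<-wellFounded)
open import Induction.WellFounded using (Acc; acc)
open import Data.Bool using (Bool; true; false; _∧_; _∨_; not) renaming (_≟_ to _≟ᵇ_)
open import Data.Bool.Properties using (¬-not; ∧-zeroʳ; ∨-zeroʳ)
open import Data.Fin using (Fin; zero; suc) renaming (_≟_ to _≟ᶠ_)
open import Data.Fin.Properties using (any?; all?; ¬∀⟶∃¬)
open import Data.Fin.Subset using (Subset; _∈_; _⊆_; ∣_∣)
open import Data.Fin.Subset.Properties using (_∈?_; ⊆-antisym; p⊂q⇒∣p∣<∣q∣)
open import Data.Vec using (tabulate)
open import Data.Vec.Properties using (lookup∘tabulate; lookup⇒[]=; []=⇒lookup)
open import Data.Product using (_×_; _,_; proj₁; proj₂; ∃)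
open import Data.Sum using (_⊎_; inj₁; inj₂)
open import Function using (_∘_; id)
open import Relation.Binary.PropositionalEquality
open import Relation.Nullary using (¬_; Dec; yes; no; does; contradiction; ¬?)
open import Relation.Nullary.Decidable using (dec-true; _×-dec_; _→-dec_)
open import Relation.Unary using (Pred; Decidable)
open import Level using (0ℓ)
open import Algebra.Properties.CommutativeSemigroup +-commutativeSemigroup using (interchange)

private
  variable
    n : ℕ

-- Vertex sets are Boolean predicates, so that sets given by decidable conditions (⟦_⟧) can be
-- counted; vertex covers keep the Subset representation and are reached through tabulate.
BoolSet : ℕ → Set
BoolSet n = Fin n → Bool

∧-true⁻ : ∀ {a b} → a ∧ b ≡ true → a ≡ true × b ≡ true
∧-true⁻ {true} b≡true = refl , b≡true

∧-true⁺ : ∀ {a b} → a ≡ true → b ≡ true → a ∧ b ≡ true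
∧-true⁺ refl refl = refl

∨-true⁻ : ∀ {a b} → a ∨ b ≡ true → a ≡ true ⊎ b ≡ true
∨-true⁻ {true} _ = inj₁ refl
∨-true⁻ {false} b≡true = inj₂ b≡true

∨-false⁻ : ∀ {a b} → a ∨ b ≡ false → a ≡ false × b ≡ false
∨-false⁻ {false} b≡false = refl , b≡false

not-true⁻ : ∀ {a} → not a ≡ true → a ≡ false
not-true⁻ {false} _ = refl

≢true⇒≡false : ∀ {a} → ¬ a ≡ true → a ≡ false
≢true⇒≡false = ¬-not

≡true⇒≢false : ∀ {a} → a ≡ true → ¬ a ≡ false
≡true⇒≢false refl ()

∅ full : BoolSet n
∅ _    = false
full _ = true

∁ : BoolSet n → BoolSet n
∁ A x = not (A x)

_∩_ _∪_ _─_ : BoolSet n → BoolSet n → BoolSet n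
(A ∩ B) x = A x ∧ B x
(A ∪ B) x = A x ∨ B x
(A ─ B) x = A x ∧ not (B x)

⟦_⟧ : {P : Pred (Fin n) 0ℓ} → Decidable P → BoolSet n
⟦ P? ⟧ x = does (P? x)

∈⟦⟧⁺ : {P : Pred (Fin n) 0ℓ} (P? : Decidable P) {x : Fin n} → P x → ⟦ P? ⟧ x ≡ true
∈⟦⟧⁺ P? {x} = dec-true (P? x)

∈⟦⟧⁻ : {P : Pred (Fin n) 0ℓ} (P? : Decidable P) {x : Fin n} → ⟦ P? ⟧ x ≡ true → P x
∈⟦⟧⁻ P? {x} with P? x
... | yes p = λ _ → p

⁅_⁆ : Fin n → BoolSet n
⁅ x ⁆ = ⟦ _≟ᶠ x ⟧

x∈⁅x⁆ : (x : Fin n) → ⁅ x ⁆ x ≡ true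
x∈⁅x⁆ x = ∈⟦⟧⁺ (_≟ᶠ x) refl

∈⁅⁆⁻ : {x : Fin n} (y : Fin n) → ⁅ x ⁆ y ≡ true → y ≡ x
∈⁅⁆⁻ {x = x} y = ∈⟦⟧⁻ (_≟ᶠ x) {y}

_⊆ᵇ_ : BoolSet n → BoolSet n → Set
A ⊆ᵇ B = ∀ x → A x ≡ true → B x ≡ true

Disjoint : BoolSet n → BoolSet n → Set
Disjoint A B = ∀ x → A x ≡ true → B x ≡ false

_⊆ᵇ?_ : (A B : BoolSet n) → Dec (A ⊆ᵇ B)
A ⊆ᵇ? B = all? (λ x → (A x ≟ᵇ true) →-dec (B x ≟ᵇ true))

¬⊆ᵇ⇒∃ : {A B : BoolSet n} → ¬ A ⊆ᵇ B → ∃ λ x → A x ≡ true × B x ≡ false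
¬⊆ᵇ⇒∃ {n} {A} {B} A⊈B with ¬∀⟶∃¬ n _ (λ x → (A x ≟ᵇ true) →-dec (B x ≟ᵇ true)) A⊈B
... | x , ¬A⇒B with A x in Ax
...   | true  = x , Ax , ≢true⇒≡false (¬A⇒B ∘ λ Bx _ → Bx)
...   | false = contradiction (λ ()) ¬A⇒B

─-antimonoʳ : {A B C : BoolSet n} → B ⊆ᵇ C → (A ─ C) ⊆ᵇ (A ─ B)
─-antimonoʳ {A = A} {B} B⊆C x A─Cx with ∧-true⁻ {A x} A─Cx | B x in Bx
... | Ax , _   | false = ∧-true⁺ Ax refl
... | _  , ¬Cx | true  = contradiction (not-true⁻ ¬Cx) (≡true⇒≢false (B⊆C x Bx))

⊆ᵇ-trans : {A B C : BoolSet n} → A ⊆ᵇ B → B ⊆ᵇ C → A ⊆ᵇ C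
⊆ᵇ-trans A⊆B B⊆C x = B⊆C x ∘ A⊆B x

A⊆A∪B : {A B : BoolSet n} → A ⊆ᵇ (A ∪ B)
A⊆A∪B x Ax rewrite Ax = refl

B⊆A∪B : {A B : BoolSet n} → B ⊆ᵇ (A ∪ B)
B⊆A∪B {A = A} x Bx rewrite Bx = ∨-zeroʳ (A x)

∪-least : {A B C : BoolSet n} → A ⊆ᵇ C → B ⊆ᵇ C → (A ∪ B) ⊆ᵇ C
∪-least {A = A} A⊆C B⊆C x ABx with ∨-true⁻ {A x} ABx
... | inj₁ Ax = A⊆C x Ax
... | inj₂ Bx = B⊆C x Bx

A─B⊆A : {A B : BoolSet n} → (A ─ B) ⊆ᵇ A
A─B⊆A {A = A} x = proj₁ ∘ ∧-true⁻ {A x}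

x∈B⇒x∉A─B : {A B : BoolSet n} {x : Fin n} → B x ≡ true → (A ─ B) x ≡ false
x∈B⇒x∉A─B {A = A} {x = x} Bx rewrite Bx = ∧-zeroʳ (A x)

indicator : Bool → ℕ
indicator true  = 1
indicator false = 0

indicator-mono : ∀ {a b} → (a ≡ true → b ≡ true) → indicator a ≤ indicator b
indicator-mono {false} _   = z≤n
indicator-mono {true}  a⇒b rewrite a⇒b refl = ≤-refl

size : BoolSet n → ℕ
size {zero}  A = 0
size {suc n} A = indicator (A zero) + size (A ∘ suc)

size-cong : {A B : BoolSet n} → (∀ x → A x ≡ B x) → size A ≡ size B
size-cong {zero}  A≗B = refl
size-cong {suc n} A≗B = cong₂ _+_ (cong indicator (A≗B zero)) (size-cong (A≗B ∘ suc))

size-mono : {A B : BoolSet n} → A ⊆ᵇ B → size A ≤ size B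
size-mono {zero}  A⊆B = z≤n
size-mono {suc n} A⊆B = +-mono-≤ (indicator-mono (A⊆B zero)) (size-mono (A⊆B ∘ suc))

size-mono-< : {A B : BoolSet n} → A ⊆ᵇ B → (x : Fin n) → A x ≡ false → B x ≡ true → size A < size B
size-mono-< A⊆B zero Ax Bx rewrite Ax | Bx = s≤s (size-mono (A⊆B ∘ suc))
size-mono-< A⊆B (suc x) Ax Bx = +-mono-≤-< (indicator-mono (A⊆B zero)) (size-mono-< (A⊆B ∘ suc) x Ax Bx)

⊆∧size≥⇒⊇ : {A B : BoolSet n} → A ⊆ᵇ B → size B ≤ size A → B ⊆ᵇ A
⊆∧size≥⇒⊇ {A = A} A⊆B B≤A x Bx with A x in Ax
... | true  = refl
... | false = contradiction B≤A (<⇒≱ (size-mono-< A⊆B x Ax Bx))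

size-─-∪⁅⁆ : {A B : BoolSet n} {x : Fin n} → A x ≡ true → B x ≡ false →
             size (A ─ (B ∪ ⁅ x ⁆)) < size (A ─ B)
size-─-∪⁅⁆ {A = A} {B} {x} Ax Bx =
  size-mono-< (─-antimonoʳ {A = A} (A⊆A∪B {A = B} {⁅ x ⁆})) x
              (x∈B⇒x∉A─B {A = A} {B ∪ ⁅ x ⁆} (B⊆A∪B {A = B} {⁅ x ⁆} x (x∈⁅x⁆ x))) (∧-true⁺ Ax (cong not Bx))

size-empty : {A : BoolSet n} → (∀ x → A x ≡ false) → size A ≡ 0
size-empty {zero}  _ = refl
size-empty {suc n} A≡∅ rewrite A≡∅ zero = size-empty (A≡∅ ∘ suc)

size-full : ∀ n → size (full {n}) ≡ n
size-full zero    = refl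
size-full (suc n) = cong suc (size-full n)

indicator-split : ∀ a b → indicator a ≡ indicator (a ∧ b) + indicator (a ∧ not b)
indicator-split false _     = refl
indicator-split true  true  = refl
indicator-split true  false = refl

size-split : (A B : BoolSet n) → size A ≡ size (A ∩ B) + size (A ─ B)
size-split {zero}  A B = refl
size-split {suc n} A B = begin
  indicator (A zero) + size (A ∘ suc)
    ≡⟨ cong₂ _+_ (indicator-split (A zero) (B zero)) (size-split (A ∘ suc) (B ∘ suc)) ⟩
  (indicator (A zero ∧ B zero) + indicator (A zero ∧ not (B zero)))
    + (size ((A ∩ B) ∘ suc) + size ((A ─ B) ∘ suc))
    ≡⟨ interchange (indicator (A zero ∧ B zero)) _ (size ((A ∩ B) ∘ suc)) _ ⟩
  size (A ∩ B) + size (A ─ B) ∎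
  where open ≡-Reasoning

indicator-∨ : ∀ a b → (a ≡ true → b ≡ false) → indicator (a ∨ b) ≡ indicator a + indicator b
indicator-∨ true  b a⇒¬b rewrite a⇒¬b refl = refl
indicator-∨ false b _ = refl

size-∪ : (A B : BoolSet n) → Disjoint A B → size (A ∪ B) ≡ size A + size B
size-∪ {zero}  A B _ = refl
size-∪ {suc n} A B A∩B≡∅ = begin
  indicator (A zero ∨ B zero) + size ((A ∪ B) ∘ suc)
    ≡⟨ cong₂ _+_ (indicator-∨ (A zero) (B zero) (A∩B≡∅ zero)) (size-∪ (A ∘ suc) (B ∘ suc) (A∩B≡∅ ∘ suc)) ⟩
  (indicator (A zero) + indicator (B zero)) + (size (A ∘ suc) + size (B ∘ suc))
    ≡⟨ interchange (indicator (A zero)) _ (size (A ∘ suc)) _ ⟩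
  size A + size B ∎
  where open ≡-Reasoning

size-─ : {A B : BoolSet n} → A ⊆ᵇ B → size B ≡ size A + size (B ─ A)
size-─ {A = A} {B} A⊆B = trans (size-split B A) (cong (_+ size (B ─ A)) (size-cong B∩A≗A))
  where
  B∩A≗A : ∀ x → B x ∧ A x ≡ A x
  B∩A≗A x with A x in Ax
  ... | true  rewrite A⊆B x Ax = refl
  ... | false = ∧-zeroʳ (B x)

size-∁ : (A : BoolSet n) → size A + size (∁ A) ≡ n
size-∁ {n} A = trans (sym (size-split full A)) (size-full n)

minimiser : {P : Pred (Fin n) 0ℓ} → Decidable P → (f : Fin n → ℕ) →
            ∃ P → ∃ λ v → P v × ∀ y → P y → f v ≤ f y
minimiser {P = P} P? f (x , Px) = descend x Px (<-wellFounded (f x))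
  where
  descend : ∀ x → P x → Acc _<_ (f x) → ∃ λ v → P v × ∀ y → P y → f v ≤ f y
  descend x Px (acc smaller) with any? (λ y → P? y ×-dec (f y <? f x))
  ... | yes (y , Py , fy<fx) = descend y Py (smaller fy<fx)
  ... | no ¬below = x , Px , λ y Py → ≮⇒≥ (λ fy<fx → ¬below (y , Py , fy<fx))

∈-tabulate⁺ : {f : BoolSet n} {x : Fin n} → f x ≡ true → x ∈ tabulate f
∈-tabulate⁺ {f = f} {x} fx = lookup⇒[]= x (tabulate f) (trans (lookup∘tabulate f x) fx)

∈-tabulate⁻ : {f : BoolSet n} {x : Fin n} → x ∈ tabulate f → f x ≡ true
∈-tabulate⁻ {f = f} {x} x∈f = trans (sym (lookup∘tabulate f x)) ([]=⇒lookup x∈f)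

∣tabulate∣ : (f : BoolSet n) → ∣ tabulate f ∣ ≡ size f
∣tabulate∣ {zero}  f = refl
∣tabulate∣ {suc n} f with f zero
... | true  = cong suc (∣tabulate∣ (f ∘ suc))
... | false = ∣tabulate∣ (f ∘ suc)

⊆∧∣∣≥⇒≡ : {S T : Subset n} → S ⊆ T → ∣ T ∣ ≤ ∣ S ∣ → S ≡ T
⊆∧∣∣≥⇒≡ {S = S} {T} S⊆T ∣T∣≤∣S∣ = ⊆-antisym S⊆T T⊆S
  where
  T⊆S : T ⊆ S
  T⊆S {x} x∈T with x ∈? S
  ... | yes x∈S = x∈S
  ... | no  x∉S = contradiction ∣T∣≤∣S∣ (<⇒≱ (p⊂q⇒∣p∣<∣q∣ (S⊆T , x , x∈T , x∉S)))

2*[m+n]≤o+[n+p] : ∀ {m n o p} → 2 * m ≤ p → n ≤ o → 2 * (m + n) ≤ o + (n + p)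
2*[m+n]≤o+[n+p] {m} {n} {o} {p} 2m≤p n≤o = begin
  2 * (m + n)    ≡⟨ *-distribˡ-+ 2 m n ⟩
  2 * m + 2 * n  ≤⟨ +-mono-≤ 2m≤p (+-monoʳ-≤ n (≤-trans (≤-reflexive (+-identityʳ n)) n≤o)) ⟩
  p + (n + o)    ≡⟨ +-comm p (n + o) ⟩
  (n + o) + p    ≡⟨ cong (_+ p) (+-comm n o) ⟩
  (o + n) + p    ≡⟨ +-assoc o n p ⟩
  o + (n + p)    ∎
  where open ≤-Reasoning

module _ {n} (G : Graph n) where

  adj-sym : ∀ {x y} → adj G x y ≡ true → adj G y x ≡ true
  adj-sym {x} {y} = trans (symmetric G y x)

  adj-irrefl : ∀ {x} → ¬ adj G x x ≡ true
  adj-irrefl {x} xx = ≡true⇒≢false xx (irreflexive G x)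

  Independent : BoolSet n → Set
  Independent A = ∀ x y → A x ≡ true → A y ≡ true → adj G x y ≡ false

  HasNeighbourIn : BoolSet n → Fin n → Set
  HasNeighbourIn A x = ∃ λ y → A y ≡ true × adj G x y ≡ true

  hasNeighbourIn? : (A : BoolSet n) → Decidable (HasNeighbourIn A)
  hasNeighbourIn? A x = any? (λ y → (A y ≟ᵇ true) ×-dec (adj G x y ≟ᵇ true))

  ¬HasNeighbourIn⇒nonadjacent : ∀ {A x y} → ¬ HasNeighbourIn A x → A y ≡ true → adj G x y ≡ false
  ¬HasNeighbourIn⇒nonadjacent {y = y} ¬N Ay = ≢true⇒≡false λ xy → ¬N (y , Ay , xy)

  independent-⊆ : ∀ {A B} → A ⊆ᵇ B → Independent B → Independent A
  independent-⊆ A⊆B indB x y Ax Ay = indB x y (A⊆B x Ax) (A⊆B y Ay)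

  -- Notions relative to a vertex set U are those of the induced subgraph G[U].
  IndependentIn : BoolSet n → BoolSet n → Set
  IndependentIn U A = A ⊆ᵇ U × Independent A

  Dominates : BoolSet n → BoolSet n → Set
  Dominates U A = ∀ x → U x ≡ true → A x ≡ false → HasNeighbourIn A x

  MaximalIndependentIn : BoolSet n → BoolSet n → Set
  MaximalIndependentIn U A = IndependentIn U A × Dominates U A

  WellCoveredIn : BoolSet n → Set
  WellCoveredIn U = ∀ A B → MaximalIndependentIn U A → MaximalIndependentIn U B → size A ≡ size B

  NoIsolatedIn : BoolSet n → Set
  NoIsolatedIn U = ∀ x → U x ≡ true → HasNeighbourIn U x

  independent-∪ : ∀ {A B} → Independent A → Independent B →
                  (∀ x y → A x ≡ true → B y ≡ true → adj G x y ≡ false) → Independent (A ∪ B)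
  independent-∪ {A} indA indB noEdge x y ABx ABy with ∨-true⁻ {A x} ABx | ∨-true⁻ {A y} ABy
  ... | inj₁ Ax | inj₁ Ay = indA x y Ax Ay
  ... | inj₁ Ax | inj₂ By = noEdge x y Ax By
  ... | inj₂ Bx | inj₁ Ay = trans (symmetric G x y) (noEdge y x Ay Bx)
  ... | inj₂ Bx | inj₂ By = indB x y Bx By

  independent-⁅⁆ : ∀ x → Independent ⁅ x ⁆
  independent-⁅⁆ x y z y∈⁅x⁆ z∈⁅x⁆ with ∈⁅⁆⁻ y y∈⁅x⁆ | ∈⁅⁆⁻ z z∈⁅x⁆
  ... | refl | refl = irreflexive G x

  x∈U⇒⁅x⁆⊆U : ∀ {U : BoolSet n} {x} → U x ≡ true → ⁅ x ⁆ ⊆ᵇ U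
  x∈U⇒⁅x⁆⊆U Ux y y∈⁅x⁆ with ∈⁅⁆⁻ y y∈⁅x⁆
  ... | refl = Ux

  Addable : BoolSet n → BoolSet n → Fin n → Set
  Addable U A x = U x ≡ true × A x ≡ false × ¬ HasNeighbourIn A x

  addable? : ∀ U A → Decidable (Addable U A)
  addable? U A x = (U x ≟ᵇ true) ×-dec (A x ≟ᵇ false) ×-dec ¬? (hasNeighbourIn? A x)

  add-independent : ∀ {U A x} → IndependentIn U A → Addable U A x → IndependentIn U (A ∪ ⁅ x ⁆)
  add-independent {A = A} {x} (A⊆U , indA) (Ux , _ , ¬N) =
    ∪-least A⊆U (x∈U⇒⁅x⁆⊆U {x = x} Ux) , independent-∪ indA (independent-⁅⁆ x) noEdge
    where
    noEdge : ∀ y z → A y ≡ true → ⁅ x ⁆ z ≡ true → adj G y z ≡ false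
    noEdge y z Ay z∈⁅x⁆ with ∈⁅⁆⁻ z z∈⁅x⁆
    ... | refl = trans (symmetric G y x) (¬HasNeighbourIn⇒nonadjacent ¬N Ay)

  extendToMaximal : ∀ {U A} → IndependentIn U A → ∃ λ K → MaximalIndependentIn U K × A ⊆ᵇ K
  extendToMaximal {U} {A} indA = extend indA (<-wellFounded (size (U ─ A)))
    where
    extend : ∀ {A} → IndependentIn U A → Acc _<_ (size (U ─ A)) → ∃ λ K → MaximalIndependentIn U K × A ⊆ᵇ K
    extend {A} indA (acc smaller) with any? (addable? U A)
    ... | yes (x , x-addable@(Ux , Ax , _))
        with extend (add-independent indA x-addable)
                    (smaller (size-─-∪⁅⁆ {A = U} {A} Ux Ax))
    ...   | K , maxK , A∪x⊆K = K , maxK , ⊆ᵇ-trans (A⊆A∪B {B = ⁅ x ⁆}) A∪x⊆K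
    extend {A} indA (acc _) | no ¬addable = A , (indA , dominates) , λ _ Ax → Ax
      where
      dominates : Dominates U A
      dominates x Ux Ax with hasNeighbourIn? A x
      ... | yes N  = N
      ... | no  ¬N = contradiction (x , Ux , Ax , ¬N) ¬addable

  nbhd : BoolSet n → Fin n → BoolSet n
  nbhd U x = U ∩ adj G x

  degree : BoolSet n → Fin n → ℕ
  degree U x = size (nbhd U x)

  module Twins (U : BoolSet n) (v : Fin n) (v∈U : U v ≡ true)
               (v-min : ∀ y → U y ≡ true → degree U v ≤ degree U y) where

    Twin : Fin n → Set
    Twin w = U w ≡ true × nbhd U w ⊆ᵇ nbhd U v

    twin? : Decidable Twin
    twin? w = (U w ≟ᵇ true) ×-dec (nbhd U w ⊆ᵇ? nbhd U v)

    twins : BoolSet n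
    twins = ⟦ twin? ⟧

    twin⁻ : ∀ {t} → twins t ≡ true → Twin t
    twin⁻ {t} = ∈⟦⟧⁻ twin? {t}

    v-twin : twins v ≡ true
    v-twin = ∈⟦⟧⁺ twin? (v∈U , λ _ → id)

    twins⊆U : twins ⊆ᵇ U
    twins⊆U t = proj₁ ∘ twin⁻

    twin-adj⁻ : ∀ {t y} → twins t ≡ true → U y ≡ true → adj G t y ≡ true → adj G v y ≡ true
    twin-adj⁻ {y = y} t∈T Uy ty = proj₂ (∧-true⁻ {U y} (proj₂ (twin⁻ t∈T) y (∧-true⁺ Uy ty)))

    -- The converse inclusion holds because v has minimum degree.
    twin-adj⁺ : ∀ {t y} → twins t ≡ true → U y ≡ true → adj G v y ≡ true → adj G t y ≡ true
    twin-adj⁺ {t} {y} t∈T Uy vy = proj₂ (∧-true⁻ {U y} (⊆∧size≥⇒⊇ Nt⊆Nv (v-min t Ut) y (∧-true⁺ Uy vy)))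
      where
      Ut : U t ≡ true
      Ut = proj₁ (twin⁻ t∈T)
      Nt⊆Nv : nbhd U t ⊆ᵇ nbhd U v
      Nt⊆Nv = proj₂ (twin⁻ t∈T)

    twin-nonadjacent : ∀ {t} → twins t ≡ true → adj G v t ≡ false
    twin-nonadjacent t∈T = ≢true⇒≡false λ vt → adj-irrefl (twin-adj⁻ t∈T v∈U (adj-sym vt))

    twins-independent : Independent twins
    twins-independent s t s∈T t∈T =
      ≢true⇒≡false λ st → ≡true⇒≢false (twin-adj⁻ s∈T (twins⊆U t t∈T) st) (twin-nonadjacent t∈T)

    rest : BoolSet n
    rest = (U ─ adj G v) ─ twins

    rest⁺ : ∀ {y} → U y ≡ true → adj G v y ≡ false → twins y ≡ false → rest y ≡ true
    rest⁺ Uy vy Ty rewrite Uy | vy | Ty = refl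

    rest⊆U : rest ⊆ᵇ U
    rest⊆U = ⊆ᵇ-trans (A─B⊆A {A = U ─ adj G v} {twins}) (A─B⊆A {A = U} {adj G v})

    rest-nonadjacent : ∀ {y} → rest y ≡ true → adj G v y ≡ false
    rest-nonadjacent {y} Ry = not-true⁻ (proj₂ (∧-true⁻ {U y} (A─B⊆A {A = U ─ adj G v} {twins} y Ry)))

    rest-not-twin : ∀ {y} → rest y ≡ true → twins y ≡ false
    rest-not-twin {y} Ry = not-true⁻ (proj₂ (∧-true⁻ {(U ─ adj G v) y} Ry))

    twins⊆U─N : twins ⊆ᵇ (U ─ adj G v)
    twins⊆U─N t t∈T = ∧-true⁺ (twins⊆U t t∈T) (cong not (twin-nonadjacent t∈T))

    size-U : size U ≡ degree U v + (size twins + size rest)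
    size-U = trans (size-split U (adj G v)) (cong (degree U v +_) (size-─ twins⊆U─N))

    rest-smaller : size rest < size U
    rest-smaller = size-mono-< rest⊆U v (x∈B⇒x∉A─B {A = U ─ adj G v} {twins} v-twin) v∈U

    rest-noIsolated : NoIsolatedIn rest
    rest-noIsolated u Ru with ¬⊆ᵇ⇒∃ (λ Nu⊆Nv → ≡true⇒≢false (∈⟦⟧⁺ twin? (rest⊆U u Ru , Nu⊆Nv)) (rest-not-twin Ru))
    ... | y , Nu-y , Nv-y = y , rest⁺ Uy vy Ty , uy
      where
      Uy : U y ≡ true
      Uy = proj₁ (∧-true⁻ Nu-y)
      uy : adj G u y ≡ true
      uy = proj₂ (∧-true⁻ {U y} Nu-y)
      vy : adj G v y ≡ false
      vy = trans (sym (cong (_∧ adj G v y) Uy)) Nv-y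
      Ty : twins y ≡ false
      Ty = ≢true⇒≡false λ y∈T → ≡true⇒≢false (twin-adj⁻ y∈T (rest⊆U u Ru) (adj-sym uy)) (rest-nonadjacent Ru)

    ∪twins-maximal : ∀ {M} → MaximalIndependentIn rest M → MaximalIndependentIn U (M ∪ twins)
    ∪twins-maximal {M} ((M⊆R , indM) , domM) =
      (∪-least (⊆ᵇ-trans M⊆R rest⊆U) twins⊆U , independent-∪ indM twins-independent noEdge) , dom
      where
      noEdge : ∀ x t → M x ≡ true → twins t ≡ true → adj G x t ≡ false
      noEdge x t Mx t∈T = ≢true⇒≡false λ xt →
        ≡true⇒≢false (twin-adj⁻ t∈T (rest⊆U x (M⊆R x Mx)) (adj-sym xt)) (rest-nonadjacent (M⊆R x Mx))
      dom : Dominates U (M ∪ twins)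
      dom x Ux x∉M∪T with ∨-false⁻ {M x} x∉M∪T | adj G v x in vx
      ... | _ , _ | true = v , B⊆A∪B {A = M} {twins} v v-twin , adj-sym vx
      ... | Mx , Tx | false with domM x (rest⁺ Ux vx Tx) Mx
      ...   | y , My , xy = y , A⊆A∪B {A = M} {twins} y My , xy

    size-∪twins : ∀ {M} → M ⊆ᵇ rest → size (M ∪ twins) ≡ size M + size twins
    size-∪twins {M} M⊆R = size-∪ M twins λ x Mx → rest-not-twin (M⊆R x Mx)

    rest-wellCovered : WellCoveredIn U → WellCoveredIn rest
    rest-wellCovered wc A B maxA maxB = +-cancelʳ-≡ (size twins) (size A) (size B) (begin
      size A + size twins    ≡⟨ size-∪twins (proj₁ (proj₁ maxA)) ⟨
      size (A ∪ twins)       ≡⟨ wc _ _ (∪twins-maximal maxA) (∪twins-maximal maxB) ⟩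
      size (B ∪ twins)       ≡⟨ size-∪twins (proj₁ (proj₁ maxB)) ⟩
      size B + size twins    ∎)
      where open ≡-Reasoning

    -- K ∖ N(v) can be traded for all twins: they share a neighbour x ∈ K, so none lies in K.
    twins≤degree-via : ∀ {x K} → U x ≡ true → adj G v x ≡ true → K x ≡ true →
                       MaximalIndependentIn U K → WellCoveredIn U → size twins ≤ degree U v
    twins≤degree-via {x} {K} Ux vx Kx maxK@((K⊆U , indK) , _) wc =
      +-cancelˡ-≤ (size K─N) (size twins) (degree U v) (begin
        size K─N + size twins               ≡⟨ size-∪ K─N twins K─N∩T≡∅ ⟨
        size (K─N ∪ twins)                  ≤⟨ size-mono K─N∪T⊆K′ ⟩
        size K′                             ≡⟨ wc K′ K maxK′ maxK ⟩
        size K                              ≡⟨ size-split K (adj G v) ⟩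
        size (K ∩ adj G v) + size K─N       ≤⟨ +-monoˡ-≤ (size K─N) (size-mono K∩N⊆nbhd) ⟩
        degree U v + size K─N               ≡⟨ +-comm (degree U v) (size K─N) ⟩
        size K─N + degree U v               ∎)
      where
      open ≤-Reasoning
      K─N : BoolSet n
      K─N = K ─ adj G v
      K─N⊆K : K─N ⊆ᵇ K
      K─N⊆K = A─B⊆A {A = K} {adj G v}
      K∩N⊆nbhd : (K ∩ adj G v) ⊆ᵇ nbhd U v
      K∩N⊆nbhd y Ky∧vy = let Ky , vy = ∧-true⁻ {K y} Ky∧vy in ∧-true⁺ (K⊆U y Ky) vy
      K─N∩T≡∅ : Disjoint K─N twins
      K─N∩T≡∅ y y∈K─N = ≢true⇒≡false λ y∈T →
        ≡true⇒≢false (twin-adj⁺ y∈T Ux vx) (indK y x (K─N⊆K y y∈K─N) Kx)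
      noEdge : ∀ y t → K─N y ≡ true → twins t ≡ true → adj G y t ≡ false
      noEdge y t y∈K─N t∈T = ≢true⇒≡false λ yt →
        ≡true⇒≢false (twin-adj⁻ t∈T (K⊆U y (K─N⊆K y y∈K─N)) (adj-sym yt)) (not-true⁻ (proj₂ (∧-true⁻ {K y} y∈K─N)))
      K─N∪T-independent : IndependentIn U (K─N ∪ twins)
      K─N∪T-independent =
        ∪-least (⊆ᵇ-trans K─N⊆K K⊆U) twins⊆U ,
        independent-∪ (independent-⊆ K─N⊆K indK) twins-independent noEdge
      K′ : BoolSet n
      K′ = proj₁ (extendToMaximal K─N∪T-independent)
      maxK′ : MaximalIndependentIn U K′
      maxK′ = proj₁ (proj₂ (extendToMaximal K─N∪T-independent))
      K─N∪T⊆K′ : (K─N ∪ twins) ⊆ᵇ K′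
      K─N∪T⊆K′ = proj₂ (proj₂ (extendToMaximal K─N∪T-independent))

    twins≤degree : NoIsolatedIn U → WellCoveredIn U → size twins ≤ degree U v
    twins≤degree noIso wc with noIso v v∈U
    ... | x , Ux , vx with extendToMaximal (x∈U⇒⁅x⁆⊆U {x = x} Ux , independent-⁅⁆ x)
    ... | K , maxK , ⁅x⁆⊆K = twins≤degree-via Ux vx (⁅x⁆⊆K x (x∈⁅x⁆ x)) maxK wc

  maximalIndependentIn-exists : ∀ U → ∃ λ M → MaximalIndependentIn U M
  maximalIndependentIn-exists U with extendToMaximal {U} {∅} ((λ _ ()) , λ _ _ ())
  ... | M , maxM , _ = M , maxM

  maximalIndependent-≤-half : ∀ {U M} → NoIsolatedIn U → WellCoveredIn U → MaximalIndependentIn U M →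
                              2 * size M ≤ size U
  maximalIndependent-≤-half {U} = halve U (<-wellFounded (size U))
    where
    halve : ∀ U → Acc _<_ (size U) → ∀ {M} → NoIsolatedIn U → WellCoveredIn U → MaximalIndependentIn U M →
            2 * size M ≤ size U
    halve U (acc smaller) {M} noIso wc maxM@((M⊆U , _) , _) with any? (λ x → U x ≟ᵇ true)
    ... | no U≡∅ = subst (λ m → 2 * m ≤ size U) (sym (size-empty M≡∅)) z≤n
      where
      M≡∅ : ∀ x → M x ≡ false
      M≡∅ x = ≢true⇒≡false λ Mx → U≡∅ (x , M⊆U x Mx)
    ... | yes U≢∅ with minimiser (λ x → U x ≟ᵇ true) (degree U) U≢∅
    ... | v , v∈U , v-min = begin
      2 * size M                             ≡⟨ cong (2 *_) size-M ⟩
      2 * (size M′ + size twins)             ≤⟨ 2*[m+n]≤o+[n+p] {size M′} induction-hypothesis (twins≤degree noIso wc) ⟩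
      degree U v + (size twins + size rest)  ≡⟨ size-U ⟨
      size U                                 ∎
      where
      open ≤-Reasoning
      open Twins U v v∈U v-min
      M′ : BoolSet n
      M′ = proj₁ (maximalIndependentIn-exists rest)
      maxM′ : MaximalIndependentIn rest M′
      maxM′ = proj₂ (maximalIndependentIn-exists rest)
      size-M : size M ≡ size M′ + size twins
      size-M = trans (wc M (M′ ∪ twins) maxM (∪twins-maximal maxM′)) (size-∪twins (proj₁ (proj₁ maxM′)))
      induction-hypothesis : 2 * size M′ ≤ size rest
      induction-hypothesis = halve rest (smaller rest-smaller) rest-noIsolated (rest-wellCovered wc) maxM′

  noIsolated-full : NoIsolatedVertices G → NoIsolatedIn full
  noIsolated-full noIso x _ with hasNeighbourIn? full x
  ... | yes N  = N
  ... | no  ¬N = contradiction (λ y → ¬HasNeighbourIn⇒nonadjacent ¬N refl) (noIso x)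

  complement-minimalCover : ∀ {M} → MaximalIndependentIn full M → IsMinimalVertexCover G (tabulate (∁ M))
  complement-minimalCover {M} ((_ , indM) , domM) = cover , minimal
    where
    cover : IsVertexCover G (tabulate (∁ M))
    cover x y xy with M x in Mx | M y in My
    ... | false | _     = inj₁ (∈-tabulate⁺ (cong not Mx))
    ... | true  | false = inj₂ (∈-tabulate⁺ (cong not My))
    ... | true  | true  = contradiction (indM x y Mx My) (≡true⇒≢false xy)
    minimal : ∀ C → IsVertexCover G C → C ⊆ tabulate (∁ M) → C ≡ tabulate (∁ M)
    minimal C coverC C⊆∁M = ⊆-antisym C⊆∁M ∁M⊆C
      where
      ∁M⊆C : tabulate (∁ M) ⊆ C
      ∁M⊆C {x} x∈∁M with domM x refl (not-true⁻ (∈-tabulate⁻ x∈∁M))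
      ... | y , My , xy with coverC x y xy
      ...   | inj₁ x∈C = x∈C
      ...   | inj₂ y∈C = contradiction (not-true⁻ (∈-tabulate⁻ (C⊆∁M y∈C))) (≡true⇒≢false My)

  size+∣∁∣ : (M : BoolSet n) → size M + ∣ tabulate (∁ M) ∣ ≡ n
  size+∣∁∣ M = trans (cong (size M +_) (∣tabulate∣ (∁ M))) (size-∁ M)

  wellCovered-full : WellCovered G → WellCoveredIn full
  wellCovered-full wc A B maxA maxB = +-cancelʳ-≡ ∣ tabulate (∁ B) ∣ (size A) (size B) (begin
    size A + ∣ tabulate (∁ B) ∣  ≡⟨ cong (size A +_) (wc _ _ (complement-minimalCover maxB) (complement-minimalCover maxA)) ⟩
    size A + ∣ tabulate (∁ A) ∣  ≡⟨ size+∣∁∣ A ⟩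
    n                            ≡⟨ size+∣∁∣ B ⟨
    size B + ∣ tabulate (∁ B) ∣  ∎)
    where open ≡-Reasoning

  minimumCover-minimal : ∀ {C} → IsVertexCover G C → (∀ S → IsVertexCover G S → ∣ C ∣ ≤ ∣ S ∣) →
                         IsMinimalVertexCover G C
  minimumCover-minimal coverC minimum = coverC , λ S coverS S⊆C → ⊆∧∣∣≥⇒≡ S⊆C (minimum S coverS)

  wellCovered⇒n≤2k : ∀ {k} → NoIsolatedVertices G → VertexCoverNumber G k → WellCovered G → n ≤ 2 * k
  wellCovered⇒n≤2k {k} noIso ((C , coverC , ∣C∣≡k) , minimum) wc = begin
    n          ≡⟨ α+k≡n ⟨
    α + k      ≤⟨ +-monoˡ-≤ k α≤k ⟩
    k + k      ≡⟨ cong (k +_) (+-identityʳ k) ⟨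
    2 * k      ∎
    where
    open ≤-Reasoning
    M : BoolSet n
    M = proj₁ (maximalIndependentIn-exists full)
    maxM : MaximalIndependentIn full M
    maxM = proj₂ (maximalIndependentIn-exists full)
    α : ℕ
    α = size M
    C-minimal : IsMinimalVertexCover G C
    C-minimal = minimumCover-minimal coverC λ S coverS → subst (_≤ ∣ S ∣) (sym ∣C∣≡k) (minimum S coverS)
    α+k≡n : α + k ≡ n
    α+k≡n = trans (cong (α +_) (sym (trans (wc _ C (complement-minimalCover maxM) C-minimal) ∣C∣≡k))) (size+∣∁∣ M)
    2α≤n : 2 * α ≤ n
    2α≤n = subst (2 * α ≤_) (size-full n) (maximalIndependent-≤-half (noIsolated-full noIso) (wellCovered-full wc) maxM)
    α≤k : α ≤ k
    α≤k = +-cancelˡ-≤ α α k (begin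
      α + α        ≡⟨ cong (α +_) (+-identityʳ α) ⟨
      2 * α        ≤⟨ 2α≤n ⟩
      n            ≡⟨ α+k≡n ⟨
      α + k        ∎)

theorem8 : (n k : ℕ) (G : Graph n) → NoIsolatedVertices G → VertexCoverNumber G k →
    (¬ WellCovered G) ⊎ (n ≤ 5 * k)
theorem8 n k G noIso vcn with n ≤? 5 * k
... | yes n≤5k = inj₂ n≤5k
... | no  n≰5k = inj₁ λ wc → n≰5k (≤-trans (wellCovered⇒n≤2k G noIso vcn wc) (*-monoˡ-≤ k {2} {5} (s≤s (s≤s z≤n))))
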